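{- Let $A,B,C$ be $\sigma$-sets. If $\overrightarrow{ABC}$ is a $\sigma$-set, then $\overrightarrow{A^{\ast}B^{\ast}C^{\ast}}$ is its antiset, i.e. $\overrightarrow{ABC} \cup \overrightarrow{A^{\ast}B^{\ast}C^{\ast}} = \emptyset$.
   Context: A $\sigma$-set is a collection whose members may be elements or antielements. Every element $x$ has an antielement $x^{\ast}$, with $(x^{\ast})^{\ast}=x$. For a $\sigma$-set $A$, $A^{\ast}=\{a^{\ast}: a\in A\}$ is the antiset of $A$, characterized by $A\cup A^{\ast}=\emptyset$. For $\sigma$-sets $X,Y$ define $X \hat{\cap} Y := \{x \in X : x^{\ast} \in Y\}$ and $X \divideontimes Y := X - (X \hat{\cap} Y)$. The fusion of $X$ and $Y$, written $X \cup Y$ (not ordinary union), is $X \cup Y = \{x : x \in X \divideontimes Y \text{ or } x \in Y \divideontimes X\}$. For $\sigma$-sets $X,Y,Z$, the chain of fusion $\overrightarrow{XYZ}$ denotes $(X\cup Y)\cup Z$. -}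

module Defs where

open import Data.Empty using (⊥)
open import Data.Product using (Σ; _×_)
open import Data.Sum using (_⊎_)
open import Relation.Nullary using (¬_)
open import Relation.Binary.PropositionalEquality using (_≡_)
open import Relation.Unary using (Pred; _∈_)
open import Level using (0ℓ)

-- Signed members over an underlying universe U of elements:
-- every element x has an antielement x*.
data Signed (U : Set) : Set where
  el   : U → Signed U
  anti : U → Signed U

module _ {U : Set} where

  _* : Signed U → Signed U
  el x * = anti x
  anti x * = el x

  Coll : Set₁
  Coll = Pred (Signed U) 0ℓ

  IsσSet : Coll → Set
  IsσSet X = ∀ x → ¬ (x ∈ X × (x *) ∈ X)

  antiset : Coll → Coll
  antiset A = λ y → Σ (Signed U) λ a → a ∈ A × y ≡ a *

  _∩̂_ : Coll → Coll → Coll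
  (X ∩̂ Y) x = x ∈ X × (x *) ∈ Y

  _⋇_ : Coll → Coll → Coll
  (X ⋇ Y) x = x ∈ X × ¬ (x ∈ (X ∩̂ Y))

  -- fusion X ∪ Y = { x : x ∈ X ⋇ Y or x ∈ Y ⋇ X }
  fusion : Coll → Coll → Coll
  fusion X Y x = x ∈ (X ⋇ Y) ⊎ x ∈ (Y ⋇ X)

  -- chain of fusion  XYZ→ = (X ∪ Y) ∪ Z
  chain : Coll → Coll → Coll → Coll
  chain X Y Z = fusion (fusion X Y) Z

-- Since _* is an involution, the antiset X* is the preimage of X under _*,
-- and preimage under _* commutes with ⋇ and fusion definitionally.  Hence the
-- antiset of A B C→ is A* B* C*→, and any collection fuses with its own
-- antiset to ∅, since x ∈ X and x* ∈ X* cancel each other.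
module Submission where

open import Data.Product using (_,_; proj₁)
open import Data.Sum using (inj₁; inj₂)
open import Relation.Binary.PropositionalEquality using (_≡_; refl; subst; sym)
open import Relation.Unary using (∅; _⊆_; _≐_; _⊢_)
open import Relation.Unary.Properties using (≐-refl; ≐-sym; ≐-trans)

open import Defs

module _ {U : Set} where

  *-involutive : (x : Signed U) → x * * ≡ x
  *-involutive (el x)   = refl
  *-involutive (anti x) = refl

  antiset≐*⊢ : (X : Coll {U}) → antiset X ≐ _* ⊢ X
  antiset≐*⊢ X = (λ { {y} (x , x∈X , refl) → subst X (sym (*-involutive x)) x∈X })
               , (λ {y} y*∈X → y * , y*∈X , sym (*-involutive y))

  *⊢-fusion : (X Y : Coll {U}) → _* ⊢ fusion X Y ≡ fusion (_* ⊢ X) (_* ⊢ Y)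
  *⊢-fusion X Y = refl

  ⋇-mono : {X X′ Y Y′ : Coll {U}} → X ≐ X′ → Y ≐ Y′ → X ⋇ Y ⊆ X′ ⋇ Y′
  ⋇-mono (X⊆X′ , X′⊆X) (_ , Y′⊆Y) (x∈X , x∉X∩̂Y) =
    X⊆X′ x∈X , λ (x∈X′ , x*∈Y′) → x∉X∩̂Y (X′⊆X x∈X′ , Y′⊆Y x*∈Y′)

  fusion-mono : {X X′ Y Y′ : Coll {U}} → X ≐ X′ → Y ≐ Y′ → fusion X Y ⊆ fusion X′ Y′
  fusion-mono X≐X′ Y≐Y′ (inj₁ x∈X⋇Y) = inj₁ (⋇-mono X≐X′ Y≐Y′ x∈X⋇Y)
  fusion-mono X≐X′ Y≐Y′ (inj₂ x∈Y⋇X) = inj₂ (⋇-mono Y≐Y′ X≐X′ x∈Y⋇X)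

  fusion-cong : {X X′ Y Y′ : Coll {U}} → X ≐ X′ → Y ≐ Y′ → fusion X Y ≐ fusion X′ Y′
  fusion-cong {X} {X′} {Y} {Y′} X≐X′ Y≐Y′ =
    fusion-mono {X} {X′} {Y} {Y′} X≐X′ Y≐Y′ ,
    fusion-mono {X′} {X} {Y′} {Y} (≐-sym X≐X′) (≐-sym Y≐Y′)

  antiset-fusion : (X Y : Coll {U}) → antiset (fusion X Y) ≐ fusion (antiset X) (antiset Y)
  antiset-fusion X Y =
    ≐-trans (antiset≐*⊢ (fusion X Y))
      (subst (_≐ fusion (antiset X) (antiset Y)) (sym (*⊢-fusion X Y))
        (fusion-cong {_* ⊢ X} {antiset X} {_* ⊢ Y} {antiset Y}
          (≐-sym (antiset≐*⊢ X)) (≐-sym (antiset≐*⊢ Y))))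

  antiset-chain : (X Y Z : Coll {U}) →
    antiset (chain X Y Z) ≐ chain (antiset X) (antiset Y) (antiset Z)
  antiset-chain X Y Z =
    ≐-trans (antiset-fusion (fusion X Y) Z)
            (fusion-cong {Y = antiset Z} (antiset-fusion X Y) ≐-refl)

  fusion-antiset-empty : (X : Coll {U}) → fusion X (antiset X) ⊆ ∅
  fusion-antiset-empty X {x} (inj₁ (x∈X , x∉X∩̂X*)) = x∉X∩̂X* (x∈X , x , x∈X , refl)
  fusion-antiset-empty X (inj₂ (x∈X* , x∉X*∩̂X)) =
    x∉X*∩̂X (x∈X* , proj₁ (antiset≐*⊢ X) x∈X*)

lemma3p4 : {U : Set} (A B C : Coll {U}) →
    IsσSet A → IsσSet B → IsσSet C →
    IsσSet (chain A B C) →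
    fusion (chain A B C) (chain (antiset A) (antiset B) (antiset C)) ≐ ∅
lemma3p4 A B C _ _ _ _ =
  (λ x∈fusion → fusion-antiset-empty (chain A B C)
                  (fusion-mono {X = chain A B C} ≐-refl (≐-sym (antiset-chain A B C)) x∈fusion))
  , λ ()
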